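{- Let $E,F$ be $t$-element subsets of $[n]$ with increasing enumerations $\tilde e_1<\dots<\tilde e_t$, $\tilde f_1<\dots<\tilde f_t$, and suppose $E\le F$. Then: (1) for integers $1\le j\le k\le t$, $E\setminus\{\tilde e_k\}\le F\setminus\{\tilde f_j\}$; in particular $E\setminus\{e\}\le F\setminus\{e\}$ for any $e\in E\cap F$; (2) for $e\in E$ and $f\in F$, if either $e$ is the largest element of $E$ with $e\le f$, or $f$ is the least element of $F$ with $e\le f$, then $E\setminus\{e\}\le F\setminus\{f\}$; (3) if $g\le h$ are elements of $[n]$ with $g\notin E$ and $h\notin F$, then $E\cup\{g\}\le F\cup\{h\}$; (4) if $g\ge h$ are elements of $[n]$ with $g\notin E$, $h\notin F$, and $E':=E\cup\{g\}\le F\cup\{h\}=:F'$, then any element of $E\cap F$ that is at the same level in $E$ and $F$ is at the same level in $E'$ and $F'$.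
   Context: For $t$-element subsets $E,F\subseteq[n]$, $E\le F$ means $\tilde e_i\le\tilde f_i$ for all $i$, where the tildes denote elements listed in increasing order. An element $e\in E$ is at level $k$ in $E$ if $e=\tilde e_k$. -}

module Defs where

open import Data.Nat using (ℕ; zero; suc)
open import Data.Fin using (Fin; zero; suc)
import Data.Fin as Fin
open import Data.Fin.Subset using (Subset; inside; outside)
open import Data.Vec using ([]; _∷_)
open import Data.List using (List; []; _∷_; map)
open import Data.Maybe using (Maybe; just; nothing)
open import Data.List.Relation.Binary.Pointwise using (Pointwise)
open import Data.Product using (∃-syntax; _×_)
open import Relation.Binary.PropositionalEquality using (_≡_)

-- Increasing enumeration  ẽ₁ < ẽ₂ < … < ẽ_t  of a subset of Fin n
-- (Fin n = {0,…,n-1} plays the role of [n] = {1,…,n}, order-isomorphically).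
enum : ∀ {n} → Subset n → List (Fin n)
enum []            = []
enum (inside ∷ p)  = zero ∷ map suc (enum p)
enum (outside ∷ p) = map suc (enum p)

infix 4 _≼_
_≼_ : ∀ {n} → Subset n → Subset n → Set
E ≼ F = Pointwise Fin._≤_ (enum E) (enum F)

_‼_ : ∀ {A : Set} → List A → ℕ → Maybe A
[]       ‼ _     = nothing
(x ∷ xs) ‼ zero  = just x
(x ∷ xs) ‼ suc k = xs ‼ k

-- e is at level k in E  :⇔  e = ẽ_{k+1}   (levels indexed from 0 here)
AtLevel : ∀ {n} → Subset n → Fin n → ℕ → Set
AtLevel E e k = enum E ‼ k ≡ just e

SameLevel : ∀ {n} → Subset n → Subset n → Fin n → Set
SameLevel E F e = ∃[ k ] (AtLevel E e k × AtLevel F e k)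

-- Deleting ẽ_k and f̃_j with j ≤ k keeps the pointwise order
-- because the shifted entries satisfy ẽ_i ≤ f̃_i < f̃_(i+1); inserting g ≤ h into both lists is
-- monotone. In (2), if e = ẽ_k and f = f̃_j had k < j, then ẽ_j would lie in E with e < ẽ_j ≤ f,
-- and f̃_k in F with e ≤ f̃_k < f, contradicting either extremality assumption; e = f ∈ E ∩ F is
-- the case of the second one. In (4), x at level k of E and F moves up one level in both when
-- g < x, stays when x is below g and h, and the remaining case h < x < g would put x at level k
-- in E′ but k + 1 in F′, which (2) rules out for a common element of E′ ≼ F′.

module Submission where

open import Defs
open import Data.Nat using (ℕ)
open import Data.Fin using (Fin)
import Data.Fin as Fin
import Data.Nat as Nat
open import Data.Fin.Subset using (Subset; _∈_; _∉_; _-_; _∪_; ⁅_⁆; ∣_∣)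
open import Data.Product using (_×_)
open import Data.Sum using (_⊎_)
open import Relation.Binary.PropositionalEquality using (_≡_)

open import Data.Bool using (if_then_else_)
open import Data.Empty using (⊥-elim)
open import Data.Fin using (zero; suc)
import Data.Fin.Properties as Finₚ
open import Data.Fin.Subset using (inside; outside; ⊥)
open import Data.Fin.Subset.Properties using (p─⊥≡p; ∪-identityʳ)
open import Data.List using (List; []; _∷_; map)
open import Data.List.Relation.Binary.Pointwise using (Pointwise; []; _∷_)
open import Data.List.Relation.Unary.All using (All; []; _∷_)
import Data.List.Relation.Unary.All as All
import Data.List.Relation.Unary.All.Properties as Allₚ
open import Data.List.Relation.Unary.AllPairs using (AllPairs; []; _∷_)
import Data.List.Relation.Unary.AllPairs as AllPairs
import Data.List.Relation.Unary.AllPairs.Properties as AllPairsₚ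
import Data.List.Sort.InsertionSort.Base as InsertionSort
open import Data.Maybe using (just)
open import Data.Nat using (zero; suc; z≤n; s≤s; z<s; s<s)
import Data.Nat.Properties as ℕ
open import Data.Product using (∃; _,_)
open import Data.Sum using (inj₁; inj₂)
open import Data.Vec using ([]; _∷_; here; there)
open import Relation.Nullary using (¬_; yes; no)
open import Relation.Nullary.Decidable using (dec-true; dec-false)
open import Relation.Binary.PropositionalEquality
  using (refl; sym; cong; subst; subst₂; module ≡-Reasoning)
open ≡-Reasoning

private variable
  A B : Set
  n i j k : ℕ
  e f g h x y : Fin n

Increasing : List (Fin n) → Set
Increasing = AllPairs Fin._<_

removeAt : ℕ → List A → List A
removeAt _       []       = []
removeAt zero    (x ∷ xs) = xs
removeAt (suc k) (x ∷ xs) = x ∷ removeAt k xs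

insert : Fin n → List (Fin n) → List (Fin n)
insert {n} = InsertionSort.insert (Finₚ.≤-decTotalOrder n)

‼-All : ∀ {P : A → Set} {xs : List A} {a} k → All P xs → xs ‼ k ≡ just a → P a
‼-All zero    (pa ∷ _)   refl = pa
‼-All (suc k) (_  ∷ pas) eq   = ‼-All k pas eq

Pointwise-‼ˡ : ∀ {R : A → B → Set} {as bs a} k → Pointwise R as bs → as ‼ k ≡ just a →
  ∃ λ b → bs ‼ k ≡ just b × R a b
Pointwise-‼ˡ zero    (r ∷ _)  refl = _ , refl , r
Pointwise-‼ˡ (suc k) (_ ∷ rs) eq   = Pointwise-‼ˡ k rs eq

Pointwise-‼ʳ : ∀ {R : A → B → Set} {as bs b} k → Pointwise R as bs → bs ‼ k ≡ just b →
  ∃ λ a → as ‼ k ≡ just a × R a b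
Pointwise-‼ʳ zero    (r ∷ _)  refl = _ , refl , r
Pointwise-‼ʳ (suc k) (_ ∷ rs) eq   = Pointwise-‼ʳ k rs eq

removeAt-map : ∀ (f : A → B) k as → removeAt k (map f as) ≡ map f (removeAt k as)
removeAt-map f _       []       = refl
removeAt-map f zero    (a ∷ as) = refl
removeAt-map f (suc k) (a ∷ as) = cong (f a ∷_) (removeAt-map f k as)

‼-map-suc : ∀ (xs : List (Fin n)) k → xs ‼ k ≡ just x → map Fin.suc xs ‼ k ≡ just (Fin.suc x)
‼-map-suc (_ ∷ xs) zero    refl = refl
‼-map-suc (_ ∷ xs) (suc k) eq   = ‼-map-suc xs k eq

‼-map-suc⁻¹ : ∀ (xs : List (Fin n)) k → map Fin.suc xs ‼ k ≡ just (Fin.suc x) → xs ‼ k ≡ just x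
‼-map-suc⁻¹ (_ ∷ xs) zero    refl = refl
‼-map-suc⁻¹ (_ ∷ xs) (suc k) eq   = ‼-map-suc⁻¹ xs k eq

‼-map-suc≢zero : ∀ (xs : List (Fin n)) k → ¬ map Fin.suc xs ‼ k ≡ just Fin.zero
‼-map-suc≢zero []       _       ()
‼-map-suc≢zero (_ ∷ xs) zero    ()
‼-map-suc≢zero (_ ∷ xs) (suc k) eq = ‼-map-suc≢zero xs k eq

Increasing-‼-< : ∀ {xs : List (Fin n)} → Increasing xs → xs ‼ i ≡ just x → xs ‼ j ≡ just y →
  i Nat.< j → x Fin.< y
Increasing-‼-< {i = zero}  {j = suc j} (x<xs ∷ _) refl eq _ = ‼-All j x<xs eq
Increasing-‼-< {i = suc i} {j = suc j} (_ ∷ ↑xs) eqx eqy (s<s i<j) = Increasing-‼-< ↑xs eqx eqy i<j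

map-suc-increasing : ∀ {xs : List (Fin n)} → Increasing xs → Increasing (map Fin.suc xs)
map-suc-increasing ↑xs = AllPairsₚ.map⁺ (AllPairs.map s<s ↑xs)

Pointwise-removeAt-∷ : ∀ {xs ys : List (Fin n)} k → Pointwise Fin._≤_ xs (y ∷ ys) →
  Increasing (y ∷ ys) → xs ‼ k ≡ just e → Pointwise Fin._≤_ (removeAt k xs) ys
Pointwise-removeAt-∷ zero    (_ ∷ xs≤ys) _ _ = xs≤ys
Pointwise-removeAt-∷ (suc k) (_ ∷ []) _ ()
Pointwise-removeAt-∷ (suc k) (x≤y ∷ xs≤ys@(_ ∷ _)) ((y<y′ ∷ _) ∷ ↑ys) eq =
  Finₚ.≤-trans x≤y (ℕ.<⇒≤ y<y′) ∷ Pointwise-removeAt-∷ k xs≤ys ↑ys eq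

Pointwise-removeAt : ∀ {xs ys : List (Fin n)} → j Nat.≤ k → Pointwise Fin._≤_ xs ys →
  Increasing ys → xs ‼ k ≡ just e → Pointwise Fin._≤_ (removeAt k xs) (removeAt j ys)
Pointwise-removeAt {j = zero}  {zero}  _         (_ ∷ xs≤ys)   _         _  = xs≤ys
Pointwise-removeAt {j = zero}  {suc k} _         xs≤ys@(_ ∷ _) ↑ys       eq =
  Pointwise-removeAt-∷ (suc k) xs≤ys ↑ys eq
Pointwise-removeAt {j = suc j} {suc k} (s≤s j≤k) (x≤y ∷ xs≤ys) (_ ∷ ↑ys) eq =
  x≤y ∷ Pointwise-removeAt j≤k xs≤ys ↑ys eq

-- insert branches on does (g ≤? x), which normalises to toℕ g ≤ᵇ toℕ x, so with-abstracting
-- g ≤? x does not reduce it; proofs split on _≤?_ and rewrite with these two equations.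
insert-≤ : ∀ (xs : List (Fin n)) → g Fin.≤ x → insert g (x ∷ xs) ≡ g ∷ x ∷ xs
insert-≤ {g = g} {x} xs g≤x =
  cong (if_then g ∷ x ∷ xs else x ∷ insert g xs) (dec-true (g Finₚ.≤? x) g≤x)

insert-≰ : ∀ (xs : List (Fin n)) → ¬ g Fin.≤ x → insert g (x ∷ xs) ≡ x ∷ insert g xs
insert-≰ {g = g} {x} xs g≰x =
  cong (if_then g ∷ x ∷ xs else x ∷ insert g xs) (dec-false (g Finₚ.≤? x) g≰x)

insert-least : ∀ {xs : List (Fin n)} → All (g Fin.≤_) xs → insert g xs ≡ g ∷ xs
insert-least []          = refl
insert-least (g≤x ∷ _)   = insert-≤ _ g≤x

insert-map-suc : ∀ (xs : List (Fin n)) →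
  insert (Fin.suc g) (map Fin.suc xs) ≡ map Fin.suc (insert g xs)
insert-map-suc []                = refl
insert-map-suc {g = g} (x ∷ xs) with g Finₚ.≤? x
... | yes g≤x = begin
  insert (Fin.suc g) (Fin.suc x ∷ map Fin.suc xs) ≡⟨ insert-≤ _ (s≤s g≤x) ⟩
  Fin.suc g ∷ Fin.suc x ∷ map Fin.suc xs          ≡⟨ cong (map Fin.suc) (insert-≤ xs g≤x) ⟨
  map Fin.suc (insert g (x ∷ xs))                 ∎
... | no g≰x = begin
  insert (Fin.suc g) (Fin.suc x ∷ map Fin.suc xs) ≡⟨ insert-≰ _ (λ sg≤sx → g≰x (Nat.s≤s⁻¹ sg≤sx)) ⟩
  Fin.suc x ∷ insert (Fin.suc g) (map Fin.suc xs) ≡⟨ cong (Fin.suc x ∷_) (insert-map-suc xs) ⟩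
  Fin.suc x ∷ map Fin.suc (insert g xs)           ≡⟨ cong (map Fin.suc) (insert-≰ xs g≰x) ⟨
  map Fin.suc (insert g (x ∷ xs))                 ∎

insert-head : ∀ {xs : List (Fin n)} → Increasing (x ∷ xs) → insert x xs ≡ x ∷ xs
insert-head (x<xs ∷ _) = insert-least (All.map ℕ.<⇒≤ x<xs)

Pointwise-insert : ∀ {xs ys : List (Fin n)} → Pointwise Fin._≤_ xs ys →
  Increasing xs → Increasing ys → g Fin.≤ h → Pointwise Fin._≤_ (insert g xs) (insert h ys)
Pointwise-insert [] _ _ g≤h = g≤h ∷ []
Pointwise-insert {g = g} {h} {x ∷ xs} {y ∷ ys} (x≤y ∷ xs≤ys) ↑x∷xs@(_ ∷ ↑xs) ↑y∷ys@(_ ∷ ↑ys) g≤h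
  with g Finₚ.≤? x | h Finₚ.≤? y
... | yes g≤x | yes h≤y rewrite insert-≤ xs g≤x | insert-≤ ys h≤y = g≤h ∷ x≤y ∷ xs≤ys
... | yes g≤x | no  h≰y rewrite insert-≤ xs g≤x | insert-≰ ys h≰y =
  Finₚ.≤-trans g≤x x≤y ∷
  subst (λ zs → Pointwise Fin._≤_ zs (insert h ys)) (insert-head ↑x∷xs)
    (Pointwise-insert xs≤ys ↑xs ↑ys (Finₚ.≤-trans x≤y (ℕ.<⇒≤ (ℕ.≰⇒> h≰y))))
... | no  g≰x | yes h≤y rewrite insert-≰ xs g≰x | insert-≤ ys h≤y =
  ℕ.<⇒≤ (ℕ.<-≤-trans (ℕ.≰⇒> g≰x) g≤h) ∷
  subst (Pointwise Fin._≤_ (insert g xs)) (insert-head ↑y∷ys)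
    (Pointwise-insert xs≤ys ↑xs ↑ys (Finₚ.≤-trans g≤h h≤y))
... | no  g≰x | no  h≰y rewrite insert-≰ xs g≰x | insert-≰ ys h≰y =
  x≤y ∷ Pointwise-insert xs≤ys ↑xs ↑ys g≤h

insert-‼-above : ∀ (xs : List (Fin n)) k → g Fin.< x → xs ‼ k ≡ just x →
  insert g xs ‼ suc k ≡ just x
insert-‼-above (c ∷ cs) zero g<x refl rewrite insert-≤ cs (ℕ.<⇒≤ g<x) = refl
insert-‼-above {g = g} (c ∷ cs) (suc k) g<x eq with g Finₚ.≤? c
... | yes g≤c rewrite insert-≤ cs g≤c = eq
... | no  g≰c rewrite insert-≰ cs g≰c = insert-‼-above cs k g<x eq

insert-‼-below : ∀ (xs : List (Fin n)) k → x Fin.< g → Increasing xs → xs ‼ k ≡ just x →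
  insert g xs ‼ k ≡ just x
insert-‼-below (c ∷ cs) zero x<g _ refl rewrite insert-≰ cs (ℕ.<⇒≱ x<g) = refl
insert-‼-below (c ∷ cs) (suc k) x<g (c<cs ∷ ↑cs) eq
  rewrite insert-≰ cs (ℕ.<⇒≱ (ℕ.<-trans (‼-All k c<cs eq) x<g)) = insert-‼-below cs k x<g ↑cs eq

enum-increasing : ∀ (E : Subset n) → Increasing (enum E)
enum-increasing []            = []
enum-increasing (inside ∷ E)  =
  Allₚ.map⁺ (All.universal (λ _ → z<s) (enum E)) ∷ map-suc-increasing (enum-increasing E)
enum-increasing (outside ∷ E) = map-suc-increasing (enum-increasing E)

AtLevel⇒∈ : ∀ (E : Subset n) k → AtLevel E x k → x ∈ E
AtLevel⇒∈ {x = zero}  (inside ∷ E)  zero    refl = here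
AtLevel⇒∈ {x = zero}  (inside ∷ E)  (suc k) eq   = ⊥-elim (‼-map-suc≢zero (enum E) k eq)
AtLevel⇒∈ {x = zero}  (outside ∷ E) k       eq   = ⊥-elim (‼-map-suc≢zero (enum E) k eq)
AtLevel⇒∈ {x = suc x} (inside ∷ E)  (suc k) eq   = there (AtLevel⇒∈ E k (‼-map-suc⁻¹ (enum E) k eq))
AtLevel⇒∈ {x = suc x} (outside ∷ E) k       eq   = there (AtLevel⇒∈ E k (‼-map-suc⁻¹ (enum E) k eq))

∈⇒AtLevel : ∀ (E : Subset n) → x ∈ E → ∃ (AtLevel E x)
∈⇒AtLevel (inside ∷ E)  here        = zero , refl
∈⇒AtLevel (inside ∷ E)  (there x∈E) with k , atE ← ∈⇒AtLevel E x∈E =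
  suc k , ‼-map-suc (enum E) k atE
∈⇒AtLevel (outside ∷ E) (there x∈E) with k , atE ← ∈⇒AtLevel E x∈E =
  k , ‼-map-suc (enum E) k atE

enum-remove : ∀ (E : Subset n) k → AtLevel E e k → enum (E - e) ≡ removeAt k (enum E)
enum-remove {e = zero}  (inside ∷ E)  zero    refl = cong (λ S → map Fin.suc (enum S)) (p─⊥≡p E)
enum-remove {e = zero}  (inside ∷ E)  (suc k) eq   = ⊥-elim (‼-map-suc≢zero (enum E) k eq)
enum-remove {e = zero}  (outside ∷ E) k       eq   = ⊥-elim (‼-map-suc≢zero (enum E) k eq)
enum-remove {e = suc e} (inside ∷ E)  (suc k) eq   =
  cong (Fin.zero ∷_) (enum-remove (outside ∷ E) k eq)
enum-remove {e = suc e} (outside ∷ E) k       eq   = begin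
  map Fin.suc (enum (E - e))
    ≡⟨ cong (map Fin.suc) (enum-remove E k (‼-map-suc⁻¹ (enum E) k eq)) ⟩
  map Fin.suc (removeAt k (enum E))
    ≡⟨ removeAt-map Fin.suc k (enum E) ⟨
  removeAt k (map Fin.suc (enum E))  ∎

enum-∪ : ∀ (E : Subset n) → g ∉ E → enum (E ∪ ⁅ g ⁆) ≡ insert g (enum E)
enum-∪ {g = zero}  (inside ∷ E)  g∉E = ⊥-elim (g∉E here)
enum-∪ {g = zero}  (outside ∷ E) _   = begin
  Fin.zero ∷ map Fin.suc (enum (E ∪ ⊥))
    ≡⟨ cong (λ S → Fin.zero ∷ map Fin.suc (enum S)) (∪-identityʳ E) ⟩
  Fin.zero ∷ map Fin.suc (enum E)
    ≡⟨ insert-least (All.universal (λ _ → z≤n) _) ⟨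
  insert Fin.zero (map Fin.suc (enum E))  ∎
enum-∪ {g = suc g} (inside ∷ E)  g∉E = begin
  Fin.zero ∷ map Fin.suc (enum (E ∪ ⁅ g ⁆))
    ≡⟨ cong (λ xs → Fin.zero ∷ map Fin.suc xs) (enum-∪ E (λ g∈E → g∉E (there g∈E))) ⟩
  Fin.zero ∷ map Fin.suc (insert g (enum E))
    ≡⟨ cong (Fin.zero ∷_) (insert-map-suc (enum E)) ⟨
  Fin.zero ∷ insert (Fin.suc g) (map Fin.suc (enum E))
    ≡⟨ insert-≰ {g = Fin.suc g} (map Fin.suc (enum E)) (λ ()) ⟨
  insert (Fin.suc g) (Fin.zero ∷ map Fin.suc (enum E))  ∎
enum-∪ {g = suc g} (outside ∷ E) g∉E = begin
  map Fin.suc (enum (E ∪ ⁅ g ⁆))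
    ≡⟨ cong (map Fin.suc) (enum-∪ E (λ g∈E → g∉E (there g∈E))) ⟩
  map Fin.suc (insert g (enum E))
    ≡⟨ insert-map-suc (enum E) ⟨
  insert (Fin.suc g) (map Fin.suc (enum E))  ∎

≼-remove-levels : ∀ (E F : Subset n) → E ≼ F → j Nat.≤ k → AtLevel E e k → AtLevel F f j →
  (E - e) ≼ (F - f)
≼-remove-levels E F E≼F j≤k atE atF =
  subst₂ (Pointwise Fin._≤_) (sym (enum-remove E _ atE)) (sym (enum-remove F _ atF))
    (Pointwise-removeAt j≤k E≼F (enum-increasing F) atE)

≼-lookup-below : ∀ (E F : Subset n) → E ≼ F → AtLevel E e k → AtLevel F f j → k Nat.< j →
  ∃ λ y → AtLevel F y k × e Fin.≤ y × y Fin.< f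
≼-lookup-below E F E≼F atE atF k<j with y , atY , e≤y ← Pointwise-‼ˡ _ E≼F atE =
  y , atY , e≤y , Increasing-‼-< (enum-increasing F) atY atF k<j

≼-lookup-above : ∀ (E F : Subset n) → E ≼ F → AtLevel E e k → AtLevel F f j → k Nat.< j →
  ∃ λ z → AtLevel E z j × e Fin.< z × z Fin.≤ f
≼-lookup-above E F E≼F atE atF k<j with z , atZ , z≤f ← Pointwise-‼ʳ _ E≼F atF =
  z , atZ , Increasing-‼-< (enum-increasing E) atE atZ k<j , z≤f

MaximalBelow : Subset n → Fin n → Fin n → Set
MaximalBelow E f e = ∀ e′ → e′ ∈ E → e′ Fin.≤ f → e′ Fin.≤ e

MinimalAbove : Subset n → Fin n → Fin n → Set
MinimalAbove F e f = ∀ f′ → f′ ∈ F → e Fin.≤ f′ → f Fin.≤ f′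

extremal-level-≤ : ∀ (E F : Subset n) → E ≼ F → AtLevel E e k → AtLevel F f j →
  MaximalBelow E f e ⊎ MinimalAbove F e f → j Nat.≤ k
extremal-level-≤ E F E≼F atE atF (inj₁ maximal) = ℕ.≮⇒≥ λ k<j →
  let z , atZ , e<z , z≤f = ≼-lookup-above E F E≼F atE atF k<j
  in  ℕ.<⇒≱ e<z (maximal z (AtLevel⇒∈ E _ atZ) z≤f)
extremal-level-≤ E F E≼F atE atF (inj₂ minimal) = ℕ.≮⇒≥ λ k<j →
  let y , atY , e≤y , y<f = ≼-lookup-below E F E≼F atE atF k<j
  in  ℕ.<⇒≱ y<f (minimal y (AtLevel⇒∈ F _ atY) e≤y)

≼-level-≤ : ∀ (E F : Subset n) → E ≼ F → AtLevel E x k → AtLevel F x j → j Nat.≤ k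
≼-level-≤ E F E≼F atE atF = extremal-level-≤ E F E≼F atE atF (inj₂ λ _ _ x≤f′ → x≤f′)

≼-remove-extremal : ∀ (E F : Subset n) → E ≼ F → e ∈ E → f ∈ F →
  MaximalBelow E f e ⊎ MinimalAbove F e f → (E - e) ≼ (F - f)
≼-remove-extremal E F E≼F e∈E f∈F extremal
  with k , atE ← ∈⇒AtLevel E e∈E | j , atF ← ∈⇒AtLevel F f∈F =
  ≼-remove-levels E F E≼F (extremal-level-≤ E F E≼F atE atF extremal) atE atF

≼-∪ : ∀ (E F : Subset n) → E ≼ F → g Fin.≤ h → g ∉ E → h ∉ F → (E ∪ ⁅ g ⁆) ≼ (F ∪ ⁅ h ⁆)
≼-∪ E F E≼F g≤h g∉E h∉F =
  subst₂ (Pointwise Fin._≤_) (sym (enum-∪ E g∉E)) (sym (enum-∪ F h∉F))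
    (Pointwise-insert E≼F (enum-increasing E) (enum-increasing F) g≤h)

AtLevel-∪-above : ∀ (E : Subset n) → g ∉ E → g Fin.< x → AtLevel E x k →
  AtLevel (E ∪ ⁅ g ⁆) x (suc k)
AtLevel-∪-above {k = k} E g∉E g<x atE =
  subst (λ xs → xs ‼ suc k ≡ just _) (sym (enum-∪ E g∉E)) (insert-‼-above (enum E) k g<x atE)

AtLevel-∪-below : ∀ (E : Subset n) → g ∉ E → x Fin.< g → AtLevel E x k → AtLevel (E ∪ ⁅ g ⁆) x k
AtLevel-∪-below {k = k} E g∉E x<g atE =
  subst (λ xs → xs ‼ k ≡ just _) (sym (enum-∪ E g∉E))
    (insert-‼-below (enum E) k x<g (enum-increasing E) atE)

∈∧∉∧≮⇒> : ∀ {S : Subset n} → x ∈ S → g ∉ S → ¬ g Fin.< x → x Fin.< g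
∈∧∉∧≮⇒> {S = S} x∈S g∉S g≮x = Finₚ.≤∧≢⇒< (ℕ.≮⇒≥ g≮x) λ x≡g → g∉S (subst (_∈ S) x≡g x∈S)

sameLevel-∪ : ∀ (E F : Subset n) → h Fin.≤ g → g ∉ E → h ∉ F → (E ∪ ⁅ g ⁆) ≼ (F ∪ ⁅ h ⁆) →
  x ∈ E → x ∈ F → SameLevel E F x → SameLevel (E ∪ ⁅ g ⁆) (F ∪ ⁅ h ⁆) x
sameLevel-∪ {h = h} {g = g} {x = x} E F h≤g g∉E h∉F E′≼F′ x∈E x∈F (k , atE , atF)
  with g Finₚ.<? x | h Finₚ.<? x
... | yes g<x | _       =
  suc k , AtLevel-∪-above E g∉E g<x atE , AtLevel-∪-above F h∉F (ℕ.≤-<-trans h≤g g<x) atF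
... | no  g≮x | no  h≮x =
  k , AtLevel-∪-below E g∉E (∈∧∉∧≮⇒> x∈E g∉E g≮x) atE
    , AtLevel-∪-below F h∉F (∈∧∉∧≮⇒> x∈F h∉F h≮x) atF
... | no  g≮x | yes h<x = ⊥-elim (ℕ.1+n≰n (≼-level-≤ (E ∪ ⁅ g ⁆) (F ∪ ⁅ h ⁆) E′≼F′
  (AtLevel-∪-below E g∉E (∈∧∉∧≮⇒> x∈E g∉E g≮x) atE) (AtLevel-∪-above F h∉F h<x atF)))

lemma4p2 : (n t : ℕ) (E F : Subset n) → ∣ E ∣ ≡ t → ∣ F ∣ ≡ t → E ≼ F →
    ((j k : ℕ) (e f : Fin n) → j Nat.≤ k → AtLevel E e k → AtLevel F f j → (E - e) ≼ (F - f))
    × ((e : Fin n) → e ∈ E → e ∈ F → (E - e) ≼ (F - e))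
    × ((e f : Fin n) → e ∈ E → f ∈ F → e Fin.≤ f →
        (((e′ : Fin n) → e′ ∈ E → e′ Fin.≤ f → e′ Fin.≤ e)
          ⊎ ((f′ : Fin n) → f′ ∈ F → e Fin.≤ f′ → f Fin.≤ f′)) →
        (E - e) ≼ (F - f))
    × ((g h : Fin n) → g Fin.≤ h → g ∉ E → h ∉ F → (E ∪ ⁅ g ⁆) ≼ (F ∪ ⁅ h ⁆))
    × ((g h : Fin n) → h Fin.≤ g → g ∉ E → h ∉ F → (E ∪ ⁅ g ⁆) ≼ (F ∪ ⁅ h ⁆) →
        (x : Fin n) → x ∈ E → x ∈ F → SameLevel E F x → SameLevel (E ∪ ⁅ g ⁆) (F ∪ ⁅ h ⁆) x)
lemma4p2 n t E F _ _ E≼F =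
    (λ j k e f → ≼-remove-levels E F E≼F)
  , (λ e e∈E e∈F → ≼-remove-extremal E F E≼F e∈E e∈F (inj₂ λ _ _ e≤f′ → e≤f′))
  , (λ e f e∈E f∈F _ → ≼-remove-extremal E F E≼F e∈E f∈F)
  , (λ g h → ≼-∪ E F E≼F)
  , (λ g h h≤g g∉E h∉F E′≼F′ x → sameLevel-∪ E F h≤g g∉E h∉F E′≼F′)
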